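{- Let $n,s\in\mathbb{N}$. Then $$\sum_{\substack{m=1\\ (m,n^s)_s=1}}^{n^s}(m-1,n^s)_s = \Phi_s(n^s)\,\tau_s(n^s).$$
   Context: $\mathbb{N}$ denotes the positive integers. For a positive integer $s$ and integers $a,b$ not both zero, $(a,b)_s$ denotes the largest $l^s$ with $l\in\mathbb{N}$ dividing both $a$ and $b$. Klee's function $\Phi_s(n)$ is the number of integers $m$ with $1\le m\le n$ and $(m,n)_s=1$. $\tau_s(N)$ denotes the number of positive integers $l$ with $l^s\mid N$. -}

module Defs where

open import Data.Nat using (ℕ; zero; suc; _+_; _*_; _∸_; _^_; _⊔_)
open import Data.Nat.Divisibility using (_∣_; _∣?_)
open import Data.Nat.Properties using (_≟_)
open import Data.List using (List; upTo; map; filter; length; foldr)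
open import Data.Nat.ListAction using (sum)
open import Data.Product using (_×_)
open import Relation.Nullary.Decidable using (_×-dec_)

range1 : ℕ → List ℕ
range1 N = map suc (upTo N)

-- For a, b not both zero and s ≥ 1, any such l satisfies l ≤ l^s ≤ a + b,
-- so it suffices to search l ∈ [1 .. a + b]; l = 1 always qualifies.
sgcd : ℕ → ℕ → ℕ → ℕ
sgcd s a b =
  foldr _⊔_ 1
    (map (λ l → l ^ s)
      (filter (λ l → ((l ^ s) ∣? a) ×-dec ((l ^ s) ∣? b)) (range1 (a + b))))

Φ : ℕ → ℕ → ℕ
Φ s n = length (filter (λ m → sgcd s m n ≟ 1) (range1 n))

-- τ_s(N) = #{ l ∈ ℕ⁺ : l^s ∣ N }; for N ≥ 1, s ≥ 1 such l satisfy l ≤ N.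
τ : ℕ → ℕ → ℕ
τ s N = length (filter (λ l → (l ^ s) ∣? N) (range1 N))

lhsSum : ℕ → ℕ → ℕ
lhsSum s N = sum (map (λ m → sgcd s (m ∸ 1) N) (filter (λ m → sgcd s m N ≟ 1) (range1 N)))

-- Put N = n^s and g x = (x, N)_s = G x ^ s, so that G x ∣ n and N = D x · g x with D x = (n / G x)^s.
-- Counting multiples of D a below N gives g a = #{y < N : N ∣ g a · g y}, and N ∣ g a · g y holds iff
-- D a ∣ y, a condition symmetric in a and y.  So the left side counts pairs (m, y) with m an s-unit and
-- D y ∣ m - 1, i.e. for each y the s-units in the class of 1 modulo D y.  By the Chinese remainder
-- theorem the number of s-units mod N in a class r modulo e^s (e ∣ n) is the same for every r that is
-- s-coprime to e^s; taking r = y / g y turns the condition into m · g y ≡ y (mod N).  Summing over y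
-- first again, the solutions y of m · g y ≡ y for a fixed s-unit m correspond to the s-divisors F^s of
-- N via y ↦ G y and F ↦ m F^s mod N, so every s-unit contributes τ_s(N).

module Submission where

open import Defs
open import Data.Bool using (Bool; true; false; _∧_; not)
open import Data.Bool.Properties using (∧-identityʳ; ∧-zeroʳ)
open import Data.List using ([]; _∷_; upTo; map; filter; length; foldr; _++_; [_])
open import Data.List.Membership.Propositional using (_∈_)
open import Data.List.Membership.Propositional.Properties using (∈-map⁺; ∈-upTo⁺; ∈-filter⁺; ∈-filter⁻)
open import Data.List.Properties using (upTo-∷ʳ; map-∘; map-++)
open import Data.List.Relation.Unary.Any using (here; there)
open import Data.Nat
open import Data.Nat.Coprimality as Coprimality using (Coprime; coprime-divisor; coprime-/gcd; coprime?; 1-coprimeTo)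
open import Data.Nat.Divisibility
open import Data.Nat.DivMod
open import Data.Nat.GCD using (gcd; gcd[m,n]∣m; gcd[m,n]∣n; gcd[m,n]≢0)
open import Data.Nat.ListAction using (sum)
open import Data.Nat.ListAction.Properties using (sum-++)
open import Data.Nat.Properties
open import Algebra.Properties.CommutativeSemigroup +-commutativeSemigroup using () renaming (interchange to +-interchange)
open import Data.Product using (∃; _×_; _,_; proj₁; proj₂)
open import Data.Sum using (_⊎_; inj₁; inj₂)
open import Function using (_∘_)
open import Function.Bundles using (mk⇔)
open import Relation.Nullary using (Dec; yes; no; does; ¬_; contradiction)
open import Relation.Nullary.Decidable using (_×-dec_; dec-true; dec-false; does-⇔)
open import Relation.Binary.PropositionalEquality hiding ([_]; J)

private
  variable
    a b c d e m n x M : ℕ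

^-distribʳ-* : ∀ m n k → (m * n) ^ k ≡ m ^ k * n ^ k
^-distribʳ-* m n zero = refl
^-distribʳ-* m n (suc k) =
  trans (cong (m * n *_) (^-distribʳ-* m n k)) ([m*n]*[o*p]≡[m*o]*[n*p] m n (m ^ k) (n ^ k))

^-monoˡ-∣ : ∀ k → m ∣ n → m ^ k ∣ n ^ k
^-monoˡ-∣ zero _ = ∣-refl
^-monoˡ-∣ (suc k) m∣n = *-pres-∣ m∣n (^-monoˡ-∣ k m∣n)

^≢0 : ∀ k → m ≢ 0 → m ^ k ≢ 0
^≢0 {m} k m≢0 = m≢0 ∘ m^n≡0⇒m≡0 m k

0^n≡0 : ∀ n .{{_ : NonZero n}} → 0 ^ n ≡ 0
0^n≡0 (suc n) = refl

∣≢0 : n ≢ 0 → m ∣ n → m ≢ 0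
∣≢0 n≢0 m∣n refl = n≢0 (0∣⇒≡0 m∣n)

coprime-∣ˡ : d ∣ a → Coprime a b → Coprime d b
coprime-∣ˡ d∣a a⊥b (c∣d , c∣b) = a⊥b (∣-trans c∣d d∣a , c∣b)

coprime-*ˡ : Coprime a c → Coprime b c → Coprime (a * b) c
coprime-*ˡ a⊥c b⊥c (d∣ab , d∣c) =
  b⊥c (coprime-divisor (coprime-∣ˡ d∣c (Coprimality.sym a⊥c)) d∣ab , d∣c)

coprime-^ˡ : ∀ k → Coprime a c → Coprime (a ^ k) c
coprime-^ˡ zero _ (d∣1 , _) = ∣1⇒≡1 d∣1
coprime-^ˡ (suc k) a⊥c = coprime-*ˡ a⊥c (coprime-^ˡ k a⊥c)

coprime-^ : ∀ k → Coprime a b → Coprime (a ^ k) (b ^ k)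
coprime-^ k a⊥b = coprime-^ˡ k (Coprimality.sym (coprime-^ˡ k (Coprimality.sym a⊥b)))

coprime-*-∣ : c ≢ 0 → Coprime a b → c * a ∣ x → c * b ∣ x → c * a * b ∣ x
coprime-*-∣ {c} {a} {b} c≢0 a⊥b (divides q refl) cb∣x =
  subst (_∣ q * (c * a)) (*-comm b (c * a)) (*-monoˡ-∣ (c * a) b∣q)
  where
    reassoc : q * (c * a) ≡ c * (a * q)
    reassoc = trans (*-comm q (c * a)) (*-assoc c a q)
    b∣q : b ∣ q
    b∣q = coprime-divisor (Coprimality.sym a⊥b)
            (*-cancelˡ-∣ c {{≢-nonZero c≢0}} (subst (c * b ∣_) reassoc cb∣x))

coprime-*-∣-^ : ∀ k → c ≢ 0 → Coprime a b → (c * a) ^ k ∣ x → (c * b) ^ k ∣ x → (c * a * b) ^ k ∣ x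
coprime-*-∣-^ {c} {a} {b} k c≢0 a⊥b [ca]^k∣x [cb]^k∣x =
  subst (_∣ _) (sym [cab]^k≡) (coprime-*-∣ (^≢0 k c≢0) (coprime-^ k a⊥b)
    (subst (_∣ _) (^-distribʳ-* c a k) [ca]^k∣x) (subst (_∣ _) (^-distribʳ-* c b k) [cb]^k∣x))
  where
    [cab]^k≡ : (c * a * b) ^ k ≡ c ^ k * a ^ k * b ^ k
    [cab]^k≡ = trans (^-distribʳ-* (c * a) b k) (cong (_* b ^ k) (^-distribʳ-* c a k))

coprime⇒*-∣ : ∀ {J K x} → Coprime J K → J ∣ x → K ∣ x → J * K ∣ x
coprime⇒*-∣ {J} {K} J⊥K (divides q refl) K∣qJ =
  subst (J * K ∣_) (*-comm J q)
    (*-monoʳ-∣ J (coprime-divisor (Coprimality.sym J⊥K) (subst (K ∣_) (*-comm q J) K∣qJ)))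

∣-by-coprime-cofactors : ∀ {G d} →
  G ≢ 0 →
  (∀ {c a b} → c ≢ 0 → G ≡ c * a → d ≡ c * b → Coprime a b → b ≡ 1) →
  d ∣ G
∣-by-coprime-cofactors {G} {d} G≢0 cofactor≡1 =
  subst₂ _∣_ (sym (trans d≡gd′ (cong (g *_) d′≡1))) (sym G≡gG′) (*-monoʳ-∣ g (1∣ G′))
  where
    g : ℕ
    g = gcd G d
    instance
      g≢0 : NonZero g
      g≢0 = ≢-nonZero (gcd[m,n]≢0 G d (inj₁ G≢0))
    G′ d′ : ℕ
    G′ = G / g
    d′ = d / g
    G≡gG′ : G ≡ g * G′
    G≡gG′ = sym (m*[n/m]≡n (gcd[m,n]∣m G d))
    d≡gd′ : d ≡ g * d′
    d≡gd′ = sym (m*[n/m]≡n (gcd[m,n]∣n G d))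
    d′≡1 : d′ ≡ 1
    d′≡1 = cofactor≡1 (≢-nonZero⁻¹ g) G≡gG′ d≡gd′ (coprime-/gcd G d)

module _ {P : ℕ → Set} (P? : ∀ k → Dec (P k)) where

  ≤-pred-¬ : ∀ {B k} → ¬ P (suc B) → k ≤ suc B → P k → k ≤ B
  ≤-pred-¬ ¬P[1+B] k≤ Pk with m≤n⇒m<n∨m≡n k≤
  ... | inj₁ k<1+B = ≤-pred k<1+B
  ... | inj₂ refl = contradiction Pk ¬P[1+B]

  bounded-maximum : ∀ B {w} → w ≤ B → P w →
                    ∃ λ k → k ≤ B × P k × (∀ {k′} → k′ ≤ B → P k′ → k′ ≤ k)
  bounded-maximum zero w≤0 Pw = 0 , z≤n , subst P (n≤0⇒n≡0 w≤0) Pw , λ k′≤0 _ → k′≤0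
  bounded-maximum (suc B) w≤ Pw with P? (suc B)
  ... | yes P[1+B] = suc B , ≤-refl , P[1+B] , λ k′≤ _ → k′≤
  ... | no ¬P[1+B] with bounded-maximum B (≤-pred-¬ ¬P[1+B] w≤ Pw) Pw
  ...   | k , k≤B , Pk , maximal =
          k , m≤n⇒m≤1+n k≤B , Pk , λ k′≤ Pk′ → maximal (≤-pred-¬ ¬P[1+B] k′≤ Pk′) Pk′

record CoprimePartSplit (e n : ℕ) : Set where
  field
    j k : ℕ
    n≡j*k : n ≡ j * k
    e∣j : e ∣ j
    j⊥k : Coprime j k
    coprime⇒∣k : ∀ {d} → d ∣ n → Coprime d e → d ∣ k

coprimePartSplit : n ≢ 0 → e ∣ n → CoprimePartSplit e n
coprimePartSplit {n} {e} n≢0 e∣n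
  with bounded-maximum (λ k → (k ∣? n) ×-dec coprime? k e) n (n≢0⇒n>0 n≢0) (1∣ n , 1-coprimeTo e)
... | k , _ , (divides j n≡j*k , k⊥e) , maximal = record
  { j = j ; k = k ; n≡j*k = n≡j*k ; e∣j = e∣j ; j⊥k = j⊥k ; coprime⇒∣k = coprime⇒∣k }
  where
    k≢0 : k ≢ 0
    k≢0 refl = n≢0 (trans n≡j*k (*-zeroʳ j))
    j≢0 : j ≢ 0
    j≢0 refl = n≢0 n≡j*k
    coprime-part-of-j≡1 : ∀ {f} → f ∣ j → Coprime f e → f ≡ 1
    coprime-part-of-j≡1 {f} f∣j f⊥e = ≤-antisym f≤1 (n≢0⇒n>0 (∣≢0 j≢0 f∣j))
      where
        fk∣n : f * k ∣ n
        fk∣n = subst (f * k ∣_) (sym n≡j*k) (*-monoˡ-∣ k f∣j)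
        f≤1 : f ≤ 1
        f≤1 = *-cancelʳ-≤ f 1 k {{≢-nonZero k≢0}}
                (subst (f * k ≤_) (sym (*-identityˡ k)) (maximal (∣⇒≤ {{≢-nonZero n≢0}} fk∣n) (fk∣n , coprime-*ˡ f⊥e k⊥e)))
    e∣j : e ∣ j
    e∣j = coprime-divisor (Coprimality.sym k⊥e) (subst (e ∣_) (trans n≡j*k (*-comm j k)) e∣n)
    j⊥k : Coprime j k
    j⊥k (c∣j , c∣k) = coprime-part-of-j≡1 c∣j (coprime-∣ˡ c∣k k⊥e)
    coprime⇒∣k : ∀ {d} → d ∣ n → Coprime d e → d ∣ k
    coprime⇒∣k d∣n d⊥e = coprime-divisor (λ (c∣d , c∣j) → coprime-part-of-j≡1 c∣j (coprime-∣ˡ c∣d d⊥e))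
                           (subst (_ ∣_) n≡j*k d∣n)

%-≡⇒∣ : ∀ m d k .{{_ : NonZero k}} → (m + d) % k ≡ m % k → k ∣ d
%-≡⇒∣ m d k eq = ∣m+n∣m⇒∣n (divides ((m + d) / k) shifted) (n∣m*n (m / k))
  where
    open ≡-Reasoning
    shifted : m / k * k + d ≡ (m + d) / k * k
    shifted = +-cancelˡ-≡ (m % k) _ _ (begin
      m % k + (m / k * k + d)        ≡⟨ +-assoc (m % k) _ d ⟨
      m % k + m / k * k + d          ≡⟨ cong (_+ d) (m≡m%n+[m/n]*n m k) ⟨
      m + d                          ≡⟨ m≡m%n+[m/n]*n (m + d) k ⟩
      (m + d) % k + (m + d) / k * k  ≡⟨ cong (_+ (m + d) / k * k) eq ⟩
      m % k + (m + d) / k * k        ∎)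

[m*k+r]%k≡r : ∀ m r k .{{_ : NonZero k}} → r < k → (m * k + r) % k ≡ r
[m*k+r]%k≡r m r k r<k = trans (%-remove-+ˡ r (n∣m*n m)) (m<n⇒m%n≡m r<k)

[m*k+r]/k≡m : ∀ m r k .{{_ : NonZero k}} → r < k → (m * k + r) / k ≡ m
[m*k+r]/k≡m m r k r<k = trans (+-distrib-/-∣ˡ r (n∣m*n m)) (trans (cong₂ _+_ (m*n/n≡m m k) (m<n⇒m/n≡0 r<k)) (+-identityʳ m))

%-*-congʳ : ∀ a b D c .{{_ : NonZero D}} .{{_ : NonZero (D * c)}} →
            a % D ≡ b % D → (a * c) % (D * c) ≡ (b * c) % (D * c)
%-*-congʳ a b D c eq = trans (sym (m%n*o≡m*o%[n*o] a D c)) (trans (cong (_* c) eq) (m%n*o≡m*o%[n*o] b D c))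

%-*-cancelʳ : ∀ a b D c .{{_ : NonZero D}} .{{_ : NonZero c}} .{{_ : NonZero (D * c)}} →
              (a * c) % (D * c) ≡ (b * c) % (D * c) → a % D ≡ b % D
%-*-cancelʳ a b D c eq =
  *-cancelʳ-≡ (a % D) (b % D) c (trans (m%n*o≡m*o%[n*o] a D c) (trans eq (sym (m%n*o≡m*o%[n*o] b D c))))

∑< : ℕ → (ℕ → ℕ) → ℕ
∑< zero f = 0
∑< (suc n) f = ∑< n f + f n

syntax ∑< n (λ i → t) = ∑[ i < n ] t

∑-cong : ∀ n {f g : ℕ → ℕ} → (∀ i → i < n → f i ≡ g i) → ∑< n f ≡ ∑< n g
∑-cong zero f≡g = refl
∑-cong (suc n) f≡g = cong₂ _+_ (∑-cong n (λ i i<n → f≡g i (m<n⇒m<1+n i<n))) (f≡g n ≤-refl)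

∑-const : ∀ n c → ∑[ i < n ] c ≡ n * c
∑-const zero c = refl
∑-const (suc n) c = trans (cong (_+ c) (∑-const n c)) (+-comm (n * c) c)

∑-distrib-+ : ∀ n (f g : ℕ → ℕ) → ∑[ i < n ] (f i + g i) ≡ ∑< n f + ∑< n g
∑-distrib-+ zero f g = refl
∑-distrib-+ (suc n) f g =
  trans (cong (_+ (f n + g n)) (∑-distrib-+ n f g)) (+-interchange (∑< n f) (∑< n g) (f n) (g n))

∑-*ˡ : ∀ n c (f : ℕ → ℕ) → ∑[ i < n ] (c * f i) ≡ c * ∑< n f
∑-*ˡ zero c f = sym (*-zeroʳ c)
∑-*ˡ (suc n) c f = trans (cong (_+ c * f n) (∑-*ˡ n c f)) (sym (*-distribˡ-+ c (∑< n f) (f n)))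

∑-*ʳ : ∀ n c (f : ℕ → ℕ) → ∑[ i < n ] (f i * c) ≡ ∑< n f * c
∑-*ʳ n c f = trans (∑-cong n (λ i _ → *-comm (f i) c)) (trans (∑-*ˡ n c f) (*-comm c (∑< n f)))

∑-comm : ∀ m n (f : ℕ → ℕ → ℕ) → ∑[ i < m ] ∑[ j < n ] f i j ≡ ∑[ j < n ] ∑[ i < m ] f i j
∑-comm zero n f = sym (trans (∑-const n 0) (*-zeroʳ n))
∑-comm (suc m) n f =
  trans (cong (_+ ∑< n (f m)) (∑-comm m n f)) (sym (∑-distrib-+ n (λ j → ∑[ i < m ] f i j) (f m)))

∑-+ : ∀ m n (f : ℕ → ℕ) → ∑< (m + n) f ≡ ∑< m f + ∑[ i < n ] f (m + i)
∑-+ m zero f = trans (cong (λ z → ∑< z f) (+-identityʳ m)) (sym (+-identityʳ _))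
∑-+ m (suc n) f =
  trans (cong (λ z → ∑< z f) (+-suc m n))
        (trans (cong (_+ f (m + n)) (∑-+ m n f)) (+-assoc (∑< m f) _ _))

∑-* : ∀ m n (f : ℕ → ℕ) → ∑< (m * n) f ≡ ∑[ q < m ] ∑[ r < n ] f (q * n + r)
∑-* zero n f = refl
∑-* (suc m) n f =
  trans (cong (λ z → ∑< z f) (+-comm n (m * n)))
        (trans (∑-+ (m * n) n f) (cong (_+ ∑[ r < n ] f (m * n + r)) (∑-* m n f)))

∑-rotate : ∀ n (f : ℕ → ℕ) → f n ≡ f 0 → ∑[ i < n ] f (suc i) ≡ ∑< n f
∑-rotate n f fn≡f0 = +-cancelʳ-≡ (f 0) _ _ (begin
  ∑[ i < n ] f (suc i) + f 0   ≡⟨ +-comm _ (f 0) ⟩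
  f 0 + ∑[ i < n ] f (suc i)   ≡⟨ ∑-+ 1 n f ⟨
  ∑< (suc n) f                 ≡⟨ cong (∑< n f +_) fn≡f0 ⟩
  ∑< n f + f 0                 ∎)
  where open ≡-Reasoning

⟦_⟧ : Bool → ℕ
⟦ true ⟧ = 1
⟦ false ⟧ = 0

⟦∧⟧ : ∀ p q → ⟦ p ∧ q ⟧ ≡ ⟦ p ⟧ * ⟦ q ⟧
⟦∧⟧ true q = sym (+-identityʳ ⟦ q ⟧)
⟦∧⟧ false q = refl

⟦⟧+⟦not⟧ : ∀ p → ⟦ p ⟧ + ⟦ not p ⟧ ≡ 1
⟦⟧+⟦not⟧ true = refl
⟦⟧+⟦not⟧ false = refl

⟦does⟧-⇔ : ∀ {P Q : Set} (P? : Dec P) (Q? : Dec Q) → (P → Q) → (Q → P) → ⟦ does P? ⟧ ≡ ⟦ does Q? ⟧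
⟦does⟧-⇔ P? Q? P→Q Q→P = cong ⟦_⟧ (does-⇔ (mk⇔ P→Q Q→P) P? Q?)

⟦does⟧*-cong : ∀ {P : Set} (P? : Dec P) x y → (P → x ≡ y) → ⟦ does P? ⟧ * x ≡ ⟦ does P? ⟧ * y
⟦does⟧*-cong (yes p) x y x≡y = cong (1 *_) (x≡y p)
⟦does⟧*-cong (no _) x y _ = refl

does≡true⇒ : ∀ {P : Set} (P? : Dec P) → does P? ≡ true → P
does≡true⇒ (yes p) _ = p

count-≡ᵇ-absent : ∀ n w → n ≤ w → ∑[ i < n ] ⟦ i ≡ᵇ w ⟧ ≡ 0
count-≡ᵇ-absent zero w _ = refl
count-≡ᵇ-absent (suc n) w n<w =
  cong₂ _+_ (count-≡ᵇ-absent n w (<⇒≤ n<w)) (cong ⟦_⟧ (dec-false (n ≟ w) (<⇒≢ n<w)))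

count-≡ᵇ : ∀ n w → w < n → ∑[ i < n ] ⟦ i ≡ᵇ w ⟧ ≡ 1
count-≡ᵇ (suc n) w w<1+n with n ≟ w
... | yes refl = cong₂ _+_ (count-≡ᵇ-absent n n ≤-refl) (cong ⟦_⟧ (dec-true (n ≟ n) refl))
... | no n≢w =
  cong₂ _+_ (count-≡ᵇ n w (≤∧≢⇒< (≤-pred w<1+n) (n≢w ∘ sym))) (cong ⟦_⟧ (dec-false (n ≟ w) n≢w))

count-residue : ∀ q k .{{_ : NonZero k}} w → w < k → ∑[ i < q * k ] ⟦ i % k ≡ᵇ w ⟧ ≡ q
count-residue q k w w<k = begin
  ∑[ i < q * k ] ⟦ i % k ≡ᵇ w ⟧                 ≡⟨ ∑-* q k _ ⟩
  ∑[ b < q ] ∑[ r < k ] ⟦ (b * k + r) % k ≡ᵇ w ⟧  ≡⟨ ∑-cong q (λ b _ → ∑-cong k (λ r r<k →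
                                                      cong (λ z → ⟦ z ≡ᵇ w ⟧) ([m*k+r]%k≡r b r k r<k))) ⟩
  ∑[ b < q ] ∑[ r < k ] ⟦ r ≡ᵇ w ⟧               ≡⟨ ∑-cong q (λ _ _ → count-≡ᵇ k w w<k) ⟩
  ∑[ b < q ] 1                                   ≡⟨ trans (∑-const q 1) (*-identityʳ q) ⟩
  q                                              ∎
  where open ≡-Reasoning

count-multiples : ∀ q k .{{_ : NonZero k}} → ∑[ i < q * k ] ⟦ does (k ∣? i) ⟧ ≡ q
count-multiples q k =
  trans (∑-cong (q * k) (λ i _ → ⟦does⟧-⇔ (k ∣? i) (i % k ≟ 0) (n∣m⇒m%n≡0 i k) (m%n≡0⇒n∣m i k)))
        (count-residue q k 0 (>-nonZero⁻¹ k))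

count+count-not : ∀ n (P : ℕ → Bool) → ∑[ i < n ] ⟦ P i ⟧ + ∑[ i < n ] ⟦ not (P i) ⟧ ≡ n
count+count-not n P = begin
  ∑[ i < n ] ⟦ P i ⟧ + ∑[ i < n ] ⟦ not (P i) ⟧  ≡⟨ ∑-distrib-+ n _ _ ⟨
  ∑[ i < n ] (⟦ P i ⟧ + ⟦ not (P i) ⟧)          ≡⟨ ∑-cong n (λ i _ → ⟦⟧+⟦not⟧ (P i)) ⟩
  ∑[ i < n ] 1                                  ≡⟨ trans (∑-const n 1) (*-identityʳ n) ⟩
  n                                             ∎
  where open ≡-Reasoning

remove : (ℕ → Bool) → ℕ → ℕ → Bool
remove Q c x = Q x ∧ not (x ≡ᵇ c)

remove-≢ : ∀ Q {c x} → x ≢ c → remove Q c x ≡ Q x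
remove-≢ Q {c} {x} x≢c = trans (cong (λ z → Q x ∧ not z) (dec-false (x ≟ c) x≢c)) (∧-identityʳ (Q x))

remove-self : ∀ Q c → remove Q c c ≡ false
remove-self Q c = trans (cong (λ z → Q c ∧ not z) (dec-true (c ≟ c) refl)) (∧-zeroʳ (Q c))

count-remove-absent : ∀ n (Q : ℕ → Bool) c → n ≤ c → ∑[ x < n ] ⟦ remove Q c x ⟧ ≡ ∑[ x < n ] ⟦ Q x ⟧
count-remove-absent n Q c n≤c = ∑-cong n (λ x x<n → cong ⟦_⟧ (remove-≢ Q (<⇒≢ (<-≤-trans x<n n≤c))))

count-remove : ∀ n (Q : ℕ → Bool) c → c < n → Q c ≡ true →
               ∑[ x < n ] ⟦ Q x ⟧ ≡ suc (∑[ x < n ] ⟦ remove Q c x ⟧)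
count-remove (suc n) Q c c<1+n Qc with n ≟ c
... | yes refl = begin
  ∑[ x < n ] ⟦ Q x ⟧ + ⟦ Q n ⟧             ≡⟨ cong₂ _+_ (sym (count-remove-absent n Q n ≤-refl)) (cong ⟦_⟧ Qc) ⟩
  ∑[ x < n ] ⟦ remove Q n x ⟧ + 1          ≡⟨ +-comm _ 1 ⟩
  suc (∑[ x < n ] ⟦ remove Q n x ⟧)        ≡⟨ cong suc (+-identityʳ _) ⟨
  suc (∑[ x < n ] ⟦ remove Q n x ⟧ + 0)    ≡⟨ cong (λ z → suc (∑[ x < n ] ⟦ remove Q n x ⟧ + ⟦ z ⟧)) (remove-self Q n) ⟨
  suc (∑[ x < suc n ] ⟦ remove Q n x ⟧)    ∎
  where
    open ≡-Reasoning
... | no n≢c = cong₂ _+_ (count-remove n Q c (≤∧≢⇒< (≤-pred c<1+n) (n≢c ∘ sym)) Qc)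
                         (cong ⟦_⟧ (sym (remove-≢ Q n≢c)))

count-≤-injection :
  ∀ A B (P Q : ℕ → Bool) (φ : ℕ → ℕ) →
  (∀ {i} → i < A → P i ≡ true → φ i < B × Q (φ i) ≡ true) →
  (∀ {i j} → i < A → j < A → P i ≡ true → P j ≡ true → φ i ≡ φ j → i ≡ j) →
  ∑[ i < A ] ⟦ P i ⟧ ≤ ∑[ j < B ] ⟦ Q j ⟧
count-≤-injection zero B P Q φ maps inj = z≤n
count-≤-injection (suc A) B P Q φ maps inj with P A in PA
... | false = begin
  ∑[ i < A ] ⟦ P i ⟧ + 0  ≡⟨ +-identityʳ _ ⟩
  ∑[ i < A ] ⟦ P i ⟧      ≤⟨ count-≤-injection A B P Q φ (maps ∘ m<n⇒m<1+n)
                               (λ i<A j<A → inj (m<n⇒m<1+n i<A) (m<n⇒m<1+n j<A)) ⟩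
  ∑[ j < B ] ⟦ Q j ⟧      ∎
  where open ≤-Reasoning
... | true = begin
  ∑[ i < A ] ⟦ P i ⟧ + 1                  ≡⟨ +-comm _ 1 ⟩
  suc (∑[ i < A ] ⟦ P i ⟧)                ≤⟨ s≤s (count-≤-injection A B P (remove Q (φ A)) φ maps′ inj′) ⟩
  suc (∑[ j < B ] ⟦ remove Q (φ A) j ⟧)   ≡⟨ count-remove B Q (φ A) (proj₁ (maps ≤-refl PA)) (proj₂ (maps ≤-refl PA)) ⟨
  ∑[ j < B ] ⟦ Q j ⟧                      ∎
  where
    open ≤-Reasoning
    inj′ : ∀ {i j} → i < A → j < A → P i ≡ true → P j ≡ true → φ i ≡ φ j → i ≡ j
    inj′ i<A j<A = inj (m<n⇒m<1+n i<A) (m<n⇒m<1+n j<A)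
    maps′ : ∀ {i} → i < A → P i ≡ true → φ i < B × remove Q (φ A) (φ i) ≡ true
    maps′ i<A Pi = proj₁ (maps (m<n⇒m<1+n i<A) Pi) ,
      trans (remove-≢ Q (<⇒≢ i<A ∘ inj (m<n⇒m<1+n i<A) ≤-refl Pi PA)) (proj₂ (maps (m<n⇒m<1+n i<A) Pi))

count-≡-permutation :
  ∀ A (P Q : ℕ → Bool) (φ : ℕ → ℕ) →
  (∀ {i} → i < A → φ i < A) →
  (∀ {i j} → i < A → j < A → φ i ≡ φ j → i ≡ j) →
  (∀ i → Q (φ i) ≡ P i) →
  ∑[ i < A ] ⟦ P i ⟧ ≡ ∑[ i < A ] ⟦ Q i ⟧
count-≡-permutation A P Q φ φ<A inj Qφ≡P = ≤-antisym (count-≤ P Q Qφ≡P) count-≥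
  where
    count-≤ : ∀ (P′ Q′ : ℕ → Bool) → (∀ i → Q′ (φ i) ≡ P′ i) →
              ∑[ i < A ] ⟦ P′ i ⟧ ≤ ∑[ i < A ] ⟦ Q′ i ⟧
    count-≤ P′ Q′ Q′φ≡P′ = count-≤-injection A A P′ Q′ φ
      (λ i<A P′i → φ<A i<A , trans (Q′φ≡P′ _) P′i) (λ i<A j<A _ _ → inj i<A j<A)
    count-≥ : ∑[ i < A ] ⟦ Q i ⟧ ≤ ∑[ i < A ] ⟦ P i ⟧
    count-≥ = +-cancelʳ-≤ (∑[ i < A ] ⟦ not (P i) ⟧) _ _ (begin
      ∑[ i < A ] ⟦ Q i ⟧ + ∑[ i < A ] ⟦ not (P i) ⟧
        ≤⟨ +-monoʳ-≤ _ (count-≤ (not ∘ P) (not ∘ Q) (cong not ∘ Qφ≡P)) ⟩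
      ∑[ i < A ] ⟦ Q i ⟧ + ∑[ i < A ] ⟦ not (Q i) ⟧   ≡⟨ count+count-not A Q ⟩
      A                                               ≡⟨ count+count-not A P ⟨
      ∑[ i < A ] ⟦ P i ⟧ + ∑[ i < A ] ⟦ not (P i) ⟧   ∎)
      where open ≤-Reasoning

crt-injective-≤ : ∀ {J K x y} → Coprime J K → .{{_ : NonZero J}} → .{{_ : NonZero K}} →
                  x ≤ y → y < J * K → x % J ≡ y % J → x % K ≡ y % K → x ≡ y
crt-injective-≤ {J} {K} {x} {y} J⊥K x≤y y<JK ≡J ≡K = sym (≤-antisym (m∸n≡0⇒m≤n y∸x≡0) x≤y)
  where
    x+[y∸x]≡y : x + (y ∸ x) ≡ y
    x+[y∸x]≡y = m+[n∸m]≡n x≤y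
    JK∣y∸x : J * K ∣ y ∸ x
    JK∣y∸x = coprime⇒*-∣ J⊥K
      (%-≡⇒∣ x (y ∸ x) J (trans (cong (_% J) x+[y∸x]≡y) (sym ≡J)))
      (%-≡⇒∣ x (y ∸ x) K (trans (cong (_% K) x+[y∸x]≡y) (sym ≡K)))
    y∸x≡0 : y ∸ x ≡ 0
    y∸x≡0 with y ∸ x ≟ 0
    ... | yes ≡0 = ≡0
    ... | no ≢0 = contradiction (≤-<-trans (m∸n≤m y x) y<JK) (≤⇒≯ (∣⇒≤ {{≢-nonZero ≢0}} JK∣y∸x))

crt-injective : ∀ {J K x y} → Coprime J K → .{{_ : NonZero J}} → .{{_ : NonZero K}} →
                x < J * K → y < J * K → x % J ≡ y % J → x % K ≡ y % K → x ≡ y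
crt-injective {x = x} {y = y} J⊥K x< y< ≡J ≡K with ≤-total x y
... | inj₁ x≤y = crt-injective-≤ J⊥K x≤y y< ≡J ≡K
... | inj₂ y≤x = sym (crt-injective-≤ J⊥K y≤x x< (sym ≡J) (sym ≡K))

∑-crt : ∀ {J K} → Coprime J K → .{{_ : NonZero J}} → .{{_ : NonZero K}} → (P Q : ℕ → Bool) →
        ∑[ m < J * K ] (⟦ P (m % J) ⟧ * ⟦ Q (m % K) ⟧) ≡ ∑[ a < J ] ⟦ P a ⟧ * ∑[ b < K ] ⟦ Q b ⟧
∑-crt {J} {K} J⊥K P Q = begin
  ∑[ m < J * K ] (⟦ P (m % J) ⟧ * ⟦ Q (m % K) ⟧)   ≡⟨ ∑-cong (J * K) (λ m _ → ⟦∧⟧ (P (m % J)) (Q (m % K))) ⟨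
  ∑[ m < J * K ] ⟦ P (m % J) ∧ Q (m % K) ⟧       ≡⟨ count-≡-permutation (J * K) _ _ φ φ< φ-injective φ-decodes ⟩
  ∑[ t < J * K ] ⟦ P (t % J) ∧ Q (t / J) ⟧       ≡⟨ cong (λ z → ∑[ t < z ] ⟦ P (t % J) ∧ Q (t / J) ⟧) (*-comm J K) ⟩
  ∑[ t < K * J ] ⟦ P (t % J) ∧ Q (t / J) ⟧       ≡⟨ ∑-* K J _ ⟩
  ∑[ b < K ] ∑[ a < J ] ⟦ P ((b * J + a) % J) ∧ Q ((b * J + a) / J) ⟧
    ≡⟨ ∑-cong K (λ b _ → ∑-cong J (λ a a<J →
         cong₂ (λ u v → ⟦ P u ∧ Q v ⟧) ([m*k+r]%k≡r b a J a<J) ([m*k+r]/k≡m b a J a<J))) ⟩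
  ∑[ b < K ] ∑[ a < J ] ⟦ P a ∧ Q b ⟧
    ≡⟨ ∑-cong K (λ b _ → trans (∑-cong J (λ a _ → ⟦∧⟧ (P a) (Q b))) (∑-*ʳ J ⟦ Q b ⟧ _)) ⟩
  ∑[ b < K ] (∑[ a < J ] ⟦ P a ⟧ * ⟦ Q b ⟧)      ≡⟨ ∑-*ˡ K (∑[ a < J ] ⟦ P a ⟧) (λ b → ⟦ Q b ⟧) ⟩
  ∑[ a < J ] ⟦ P a ⟧ * ∑[ b < K ] ⟦ Q b ⟧        ∎
  where
    open ≡-Reasoning
    φ : ℕ → ℕ
    φ m = m % K * J + m % J
    φ%J : ∀ m → φ m % J ≡ m % J
    φ%J m = [m*k+r]%k≡r (m % K) (m % J) J (m%n<n m J)
    φ/J : ∀ m → φ m / J ≡ m % K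
    φ/J m = [m*k+r]/k≡m (m % K) (m % J) J (m%n<n m J)
    φ< : ∀ {m} → m < J * K → φ m < J * K
    φ< {m} _ = <-≤-trans (+-monoʳ-< (m % K * J) (m%n<n m J))
                         (subst₂ _≤_ (+-comm J _) (*-comm K J) (*-monoˡ-≤ J (m%n<n m K)))
    φ-injective : ∀ {i j} → i < J * K → j < J * K → φ i ≡ φ j → i ≡ j
    φ-injective {i} {j} i< j< φi≡φj = crt-injective J⊥K i< j<
      (trans (sym (φ%J i)) (trans (cong (_% J) φi≡φj) (φ%J j)))
      (trans (sym (φ/J i)) (trans (cong (_/ J) φi≡φj) (φ/J j)))
    φ-decodes : ∀ m → (P (φ m % J) ∧ Q (φ m / J)) ≡ (P (m % J) ∧ Q (m % K))
    φ-decodes m = cong₂ _∧_ (cong P (φ%J m)) (cong Q (φ/J m))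

sum-map-upTo : ∀ (f : ℕ → ℕ) n → sum (map f (upTo n)) ≡ ∑< n f
sum-map-upTo f zero = refl
sum-map-upTo f (suc n) = begin
  sum (map f (upTo (suc n)))            ≡⟨ cong (sum ∘ map f) (upTo-∷ʳ n) ⟨
  sum (map f (upTo n ++ [ n ]))         ≡⟨ cong sum (map-++ f (upTo n) [ n ]) ⟩
  sum (map f (upTo n) ++ [ f n ])       ≡⟨ sum-++ (map f (upTo n)) [ f n ] ⟩
  sum (map f (upTo n)) + (f n + 0)      ≡⟨ cong₂ _+_ (sum-map-upTo f n) (+-identityʳ (f n)) ⟩
  ∑< n f + f n                          ∎
  where open ≡-Reasoning

sum-map-range1 : ∀ (f : ℕ → ℕ) n → sum (map f (range1 n)) ≡ ∑[ i < n ] f (suc i)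
sum-map-range1 f n = trans (cong sum (sym (map-∘ (upTo n)))) (sum-map-upTo (f ∘ suc) n)

module _ {P : ℕ → Set} (P? : ∀ x → Dec (P x)) where

  sum-map-filter : ∀ (h : ℕ → ℕ) xs → sum (map h (filter P? xs)) ≡ sum (map (λ x → ⟦ does (P? x) ⟧ * h x) xs)
  sum-map-filter h [] = refl
  sum-map-filter h (x ∷ xs) with does (P? x)
  ... | true = cong₂ _+_ (sym (+-identityʳ (h x))) (sum-map-filter h xs)
  ... | false = sum-map-filter h xs

  length-filter : ∀ xs → length (filter P? xs) ≡ sum (map (λ x → ⟦ does (P? x) ⟧) xs)
  length-filter [] = refl
  length-filter (x ∷ xs) with does (P? x)
  ... | true = cong suc (length-filter xs)
  ... | false = length-filter xs

∈-range1⁺ : ∀ {d N} → 0 < d → d ≤ N → d ∈ range1 N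
∈-range1⁺ {suc d} _ d<N = ∈-map⁺ suc (∈-upTo⁺ d<N)

foldr-⊔-upper : ∀ (f : ℕ → ℕ) {y ys} → y ∈ ys → f y ≤ foldr _⊔_ 1 (map f ys)
foldr-⊔-upper f (here refl) = m≤m⊔n _ _
foldr-⊔-upper f {ys = z ∷ _} (there y∈ys) = ≤-trans (foldr-⊔-upper f y∈ys) (m≤n⊔m (f z) _)

foldr-⊔-attained : ∀ (f : ℕ → ℕ) ys →
                   foldr _⊔_ 1 (map f ys) ≡ 1 ⊎ ∃ λ y → y ∈ ys × foldr _⊔_ 1 (map f ys) ≡ f y
foldr-⊔-attained f [] = inj₁ refl
foldr-⊔-attained f (y ∷ ys) with ⊔-sel (f y) (foldr _⊔_ 1 (map f ys)) | foldr-⊔-attained f ys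
... | inj₁ ≡fy | _ = inj₂ (y , here refl , ≡fy)
... | inj₂ ≡rest | inj₁ rest≡1 = inj₁ (trans ≡rest rest≡1)
... | inj₂ ≡rest | inj₂ (z , z∈ys , rest≡fz) = inj₂ (z , there z∈ys , trans ≡rest rest≡fz)

module _ (s : ℕ) .{{_ : NonZero s}} where

  m≤m^s : ∀ m → m ≤ m ^ s
  m≤m^s zero = z≤n
  m≤m^s m@(suc _) = subst (_≤ m ^ s) (*-identityʳ m) (^-monoʳ-≤ m (>-nonZero⁻¹ s))

  ^-cancelˡ-≤ : m ^ s ≤ n ^ s → m ≤ n
  ^-cancelˡ-≤ m^s≤n^s = ≮⇒≥ (λ n<m → <⇒≱ (^-monoˡ-< s n<m) m^s≤n^s)

  ^-injectiveˡ : m ^ s ≡ n ^ s → m ≡ n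
  ^-injectiveˡ eq = ≤-antisym (^-cancelˡ-≤ (≤-reflexive eq)) (^-cancelˡ-≤ (≤-reflexive (sym eq)))

  ^≡1⇒≡1 : m ^ s ≡ 1 → m ≡ 1
  ^≡1⇒≡1 eq = ^-injectiveˡ (trans eq (sym (^-zeroˡ s)))

  ^-cancel-∣ : n ≢ 0 → d ^ s ∣ n ^ s → d ∣ n
  ^-cancel-∣ {n} {d} n≢0 d^s∣n^s = ∣-by-coprime-cofactors n≢0 cofactor≡1
    where
      cofactor≡1 : ∀ {c a b} → c ≢ 0 → n ≡ c * a → d ≡ c * b → Coprime a b → b ≡ 1
      cofactor≡1 {c} {a} {b} c≢0 n≡ca d≡cb a⊥b = ^≡1⇒≡1 (coprime-^ s a⊥b (b^s∣a^s , ∣-refl))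
        where
          [cb]^s∣[ca]^s : (c * b) ^ s ∣ (c * a) ^ s
          [cb]^s∣[ca]^s = subst₂ (λ u v → v ^ s ∣ u ^ s) n≡ca d≡cb d^s∣n^s
          b^s∣a^s : b ^ s ∣ a ^ s
          b^s∣a^s = *-cancelˡ-∣ (c ^ s) {{≢-nonZero (^≢0 s c≢0)}}
                      (subst₂ _∣_ (^-distribʳ-* c b s) (^-distribʳ-* c a s) [cb]^s∣[ca]^s)

  CommonSDivisor : ℕ → ℕ → ℕ → Set
  CommonSDivisor x M d = d ^ s ∣ x × d ^ s ∣ M

  IsSGCD : ℕ → ℕ → ℕ → Set
  IsSGCD x M G = CommonSDivisor x M G × (∀ {d} → CommonSDivisor x M d → d ∣ G)

  SCoprime : ℕ → ℕ → Set
  SCoprime x M = ∀ {d} → CommonSDivisor x M d → d ≡ 1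

  commonSDivisor? : ∀ x M d → Dec (CommonSDivisor x M d)
  commonSDivisor? x M d = ((d ^ s) ∣? x) ×-dec ((d ^ s) ∣? M)

  1-commonSDivisor : CommonSDivisor x M 1
  1-commonSDivisor {x} {M} = subst (_∣ x) (sym (^-zeroˡ s)) (1∣ x) , subst (_∣ M) (sym (^-zeroˡ s)) (1∣ M)

  commonSDivisor≢0 : M ≢ 0 → CommonSDivisor x M d → d ≢ 0
  commonSDivisor≢0 M≢0 (_ , d^s∣M) refl = ∣≢0 M≢0 d^s∣M (0^n≡0 s)

  sgcd-upper : M ≢ 0 → CommonSDivisor x M d → d ^ s ≤ sgcd s x M
  sgcd-upper {M} {x} {d} M≢0 common@(_ , d^s∣M) =
    foldr-⊔-upper (_^ s) (∈-filter⁺ (commonSDivisor? x M) (∈-range1⁺ 0<d d≤x+M) common)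
    where
      0<d : 0 < d
      0<d = n≢0⇒n>0 (commonSDivisor≢0 M≢0 common)
      d≤x+M : d ≤ x + M
      d≤x+M = ≤-trans (m≤m^s d) (≤-trans (∣⇒≤ {{≢-nonZero M≢0}} d^s∣M) (m≤n+m M x))

  sgcd-attained : ∃ λ G → sgcd s x M ≡ G ^ s × CommonSDivisor x M G
  sgcd-attained {x} {M} with foldr-⊔-attained (_^ s) (filter (commonSDivisor? x M) (range1 (x + M)))
  ... | inj₁ ≡1 = 1 , trans ≡1 (sym (^-zeroˡ s)) , 1-commonSDivisor
  ... | inj₂ (G , G∈ , ≡G^s) = G , ≡G^s , proj₂ (∈-filter⁻ (commonSDivisor? x M) {xs = range1 (x + M)} G∈)

  sgcd-spec : M ≢ 0 → ∃ λ G → sgcd s x M ≡ G ^ s × IsSGCD x M G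
  sgcd-spec {M} {x} M≢0 with sgcd-attained {x} {M}
  ... | G , sgcd≡G^s , common-G = G , sgcd≡G^s , common-G , greatest
    where
      greatest : ∀ {d} → CommonSDivisor x M d → d ∣ G
      greatest {d} common-d = ∣-by-coprime-cofactors (commonSDivisor≢0 M≢0 common-G) cofactor≡1
        where
          cofactor≡1 : ∀ {c a b} → c ≢ 0 → G ≡ c * a → d ≡ c * b → Coprime a b → b ≡ 1
          cofactor≡1 {c} {a} {b} c≢0 G≡ca d≡cb a⊥b = ≤-antisym b≤1 (n≢0⇒n>0 b≢0)
            where
              [cab]^s∣ : ∀ {z} → G ^ s ∣ z → d ^ s ∣ z → (c * a * b) ^ s ∣ z
              [cab]^s∣ G^s∣z d^s∣z = coprime-*-∣-^ s c≢0 a⊥b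
                (subst (λ u → u ^ s ∣ _) G≡ca G^s∣z) (subst (λ u → u ^ s ∣ _) d≡cb d^s∣z)
              cab≤ca : c * a * b ≤ c * a * 1
              cab≤ca = subst (c * a * b ≤_) (trans G≡ca (sym (*-identityʳ (c * a))))
                (^-cancelˡ-≤ (subst (_ ≤_) sgcd≡G^s (sgcd-upper M≢0
                  ([cab]^s∣ (proj₁ common-G) (proj₁ common-d) , [cab]^s∣ (proj₂ common-G) (proj₂ common-d)))))
              b≤1 : b ≤ 1
              b≤1 = *-cancelˡ-≤ (c * a) {{≢-nonZero (subst (_≢ 0) G≡ca (commonSDivisor≢0 M≢0 common-G))}} cab≤ca
              b≢0 : b ≢ 0
              b≢0 refl = commonSDivisor≢0 M≢0 common-d (trans d≡cb (*-zeroʳ c))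

  IsSGCD-unique : ∀ {G H} → IsSGCD x M G → IsSGCD x M H → G ≡ H
  IsSGCD-unique (common-G , greatest-G) (common-H , greatest-H) = ∣-antisym (greatest-H common-G) (greatest-G common-H)

  sgcd≡^s : ∀ {M x G} → M ≢ 0 → IsSGCD x M G → sgcd s x M ≡ G ^ s
  sgcd≡^s {M} {x} M≢0 IsSGCD-G =
    let H , sgcd≡H^s , IsSGCD-H = sgcd-spec {M} {x} M≢0
    in trans sgcd≡H^s (cong (_^ s) (IsSGCD-unique IsSGCD-H IsSGCD-G))

  sgcd≡1⇒SCoprime : M ≢ 0 → sgcd s x M ≡ 1 → SCoprime x M
  sgcd≡1⇒SCoprime {M} {x} M≢0 sgcd≡1 common-d =
    let G , sgcd≡G^s , _ , greatest = sgcd-spec {M} {x} M≢0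
    in ∣1⇒≡1 (subst (_ ∣_) (^≡1⇒≡1 (trans (sym sgcd≡G^s) sgcd≡1)) (greatest common-d))

  SCoprime⇒sgcd≡1 : M ≢ 0 → SCoprime x M → sgcd s x M ≡ 1
  SCoprime⇒sgcd≡1 M≢0 coprime =
    trans (sgcd≡^s M≢0 (1-commonSDivisor , ∣-reflexive ∘ coprime)) (^-zeroˡ s)

  sgcd-cong : ∀ {x y} → M ≢ 0 → (∀ {d} → d ^ s ∣ M → d ^ s ∣ x → d ^ s ∣ y) →
              (∀ {d} → d ^ s ∣ M → d ^ s ∣ y → d ^ s ∣ x) → sgcd s x M ≡ sgcd s y M
  sgcd-cong {M} {x} {y} M≢0 x⇒y y⇒x =
    let G , sgcd≡G^s , (G^s∣x , G^s∣M) , greatest = sgcd-spec {M} {x} M≢0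
    in trans sgcd≡G^s (sym (sgcd≡^s M≢0
         ((x⇒y G^s∣M G^s∣x , G^s∣M) , λ (d^s∣y , d^s∣M) → greatest (y⇒x d^s∣M d^s∣y , d^s∣M))))

  sgcd-% : ∀ x M .{{_ : NonZero M}} → sgcd s (x % M) M ≡ sgcd s x M
  sgcd-% x M = sgcd-cong (≢-nonZero⁻¹ M) (λ d^s∣M → ∣n∣m%n⇒∣m d^s∣M) (λ d^s∣M d^s∣x → %-presˡ-∣ d^s∣x d^s∣M)

  module _ (n : ℕ) .{{_ : NonZero n}} where

    n≢0 : n ≢ 0
    n≢0 = ≢-nonZero⁻¹ n

    N : ℕ
    N = n ^ s

    N≢0 : N ≢ 0
    N≢0 = ^≢0 s n≢0

    instance
      N-nonZero : NonZero N
      N-nonZero = ≢-nonZero N≢0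

    g : ℕ → ℕ
    g x = sgcd s x N

    isUnit : ℕ → Bool
    isUnit m = g m ≡ᵇ 1

    G : ℕ → ℕ
    G x = proj₁ (sgcd-spec {N} {x} N≢0)

    g≡G^s : ∀ x → g x ≡ G x ^ s
    g≡G^s x = proj₁ (proj₂ (sgcd-spec {N} {x} N≢0))

    G-IsSGCD : ∀ x → IsSGCD x N (G x)
    G-IsSGCD x = proj₂ (proj₂ (sgcd-spec {N} {x} N≢0))

    G∣n : ∀ x → G x ∣ n
    G∣n x = ^-cancel-∣ n≢0 (proj₂ (proj₁ (G-IsSGCD x)))

    G≢0 : ∀ x → G x ≢ 0
    G≢0 x = ∣≢0 n≢0 (G∣n x)

    g≢0 : ∀ x → g x ≢ 0
    g≢0 x = subst (_≢ 0) (sym (g≡G^s x)) (^≢0 s (G≢0 x))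

    g∣x : ∀ x → g x ∣ x
    g∣x x = subst (_∣ x) (sym (g≡G^s x)) (proj₁ (proj₁ (G-IsSGCD x)))

    cofactor : ℕ → ℕ
    cofactor x = quotient (G∣n x)

    n≡cofactor*G : ∀ x → n ≡ cofactor x * G x
    n≡cofactor*G x = _∣_.equality (G∣n x)

    D : ℕ → ℕ
    D x = cofactor x ^ s

    N≡D*g : ∀ x → N ≡ D x * g x
    N≡D*g x = begin
      n ^ s                         ≡⟨ cong (_^ s) (n≡cofactor*G x) ⟩
      (cofactor x * G x) ^ s        ≡⟨ ^-distribʳ-* (cofactor x) (G x) s ⟩
      cofactor x ^ s * G x ^ s      ≡⟨ cong (D x *_) (g≡G^s x) ⟨
      D x * g x                     ∎
      where open ≡-Reasoning

    D≢0 : ∀ x → D x ≢ 0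
    D≢0 x D≡0 = N≢0 (trans (N≡D*g x) (cong (_* g x) D≡0))

    N∣g*g⇒D∣ : ∀ a b → N ∣ g a * g b → D a ∣ b
    N∣g*g⇒D∣ a b N∣gagb = ∣-trans (*-cancelʳ-∣ (g a) {{≢-nonZero (g≢0 a)}} Da*ga∣gb*ga) (g∣x b)
      where
        Da*ga∣gb*ga : D a * g a ∣ g b * g a
        Da*ga∣gb*ga = subst₂ _∣_ (N≡D*g a) (*-comm (g a) (g b)) N∣gagb

    D∣⇒N∣g*g : ∀ a b → D a ∣ b → N ∣ g a * g b
    D∣⇒N∣g*g a b Da∣b = subst (N ∣_) N-multiple (^-monoˡ-∣ s n∣Gb*Ga)
      where
        Da∣N : D a ∣ N
        Da∣N = subst (D a ∣_) (sym (N≡D*g a)) (m∣m*n (g a))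
        n∣Gb*Ga : n ∣ G b * G a
        n∣Gb*Ga = subst (_∣ G b * G a) (sym (n≡cofactor*G a)) (*-monoˡ-∣ (G a) (proj₂ (G-IsSGCD b) (Da∣b , Da∣N)))
        N-multiple : (G b * G a) ^ s ≡ g a * g b
        N-multiple = trans (^-distribʳ-* (G b) (G a) s)
                       (trans (cong₂ _*_ (sym (g≡G^s b)) (sym (g≡G^s a))) (*-comm (g b) (g a)))

    g≡count : ∀ a → g a ≡ ∑[ y < N ] ⟦ does (N ∣? g a * g y) ⟧
    g≡count a = sym (begin
      ∑[ y < N ] ⟦ does (N ∣? g a * g y) ⟧
        ≡⟨ ∑-cong N (λ y _ → ⟦does⟧-⇔ (N ∣? g a * g y) (D a ∣? y) (N∣g*g⇒D∣ a y) (D∣⇒N∣g*g a y)) ⟩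
      ∑[ y < N ] ⟦ does (D a ∣? y) ⟧
        ≡⟨ cong (λ z → ∑[ y < z ] ⟦ does (D a ∣? y) ⟧) (trans (N≡D*g a) (*-comm (D a) (g a))) ⟩
      ∑[ y < g a * D a ] ⟦ does (D a ∣? y) ⟧     ≡⟨ count-multiples (g a) (D a) {{≢-nonZero (D≢0 a)}} ⟩
      g a                                        ∎)
      where open ≡-Reasoning

    unitsIn : ∀ E .{{_ : NonZero E}} → ℕ → ℕ
    unitsIn E r = ∑[ i < N ] (⟦ isUnit (suc i) ⟧ * ⟦ suc i % E ≡ᵇ r % E ⟧)

    -- With n = j k and k the largest divisor of n coprime to e, whether m ≡ r (mod e^s) is an s-unit
    -- modulo N depends only on m mod k^s.
    module ResidueClass {e : ℕ} (e∣n : e ∣ n) where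

      open CoprimePartSplit (coprimePartSplit n≢0 e∣n)

      E J K : ℕ
      E = e ^ s
      J = j ^ s
      K = k ^ s

      j≢0 : j ≢ 0
      j≢0 j≡0 = n≢0 (trans n≡j*k (cong (_* k) j≡0))

      k≢0 : k ≢ 0
      k≢0 k≡0 = n≢0 (trans n≡j*k (trans (cong (j *_) k≡0) (*-zeroʳ j)))

      K≢0 : K ≢ 0
      K≢0 = ^≢0 s k≢0

      instance
        E-nonZero : NonZero E
        E-nonZero = ≢-nonZero (^≢0 s (∣≢0 n≢0 e∣n))
        J-nonZero : NonZero J
        J-nonZero = ≢-nonZero (^≢0 s j≢0)
        K-nonZero : NonZero K
        K-nonZero = ≢-nonZero K≢0

      N≡J*K : N ≡ J * K
      N≡J*K = trans (cong (_^ s) n≡j*k) (^-distribʳ-* j k s)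

      E∣J : E ∣ J
      E∣J = ^-monoˡ-∣ s e∣j

      E∣N : E ∣ N
      E∣N = ^-monoˡ-∣ s e∣n

      K∣N : K ∣ N
      K∣N = subst (K ∣_) (sym N≡J*K) (n∣m*n J)

      isUnitMod-K : ℕ → Bool
      isUnitMod-K b = sgcd s b K ≡ᵇ 1

      module _ {r} (r⊥E : SCoprime r E) where

        SCoprime-K⇒SCoprime-N : ∀ {m} → m % E ≡ r % E → SCoprime m K → SCoprime m N
        SCoprime-K⇒SCoprime-N {m} m≡r m⊥K {d} (d^s∣m , d^s∣N) = m⊥K (d^s∣m , ^-monoˡ-∣ s d∣k)
          where
            d⊥e : Coprime d e
            d⊥e {c} (c∣d , c∣e) = r⊥E (c^s∣r , c^s∣E)
              where
                c^s∣E : c ^ s ∣ E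
                c^s∣E = ^-monoˡ-∣ s c∣e
                c^s∣r : c ^ s ∣ r
                c^s∣r = ∣n∣m%n⇒∣m c^s∣E (subst (c ^ s ∣_) m≡r (%-presˡ-∣ (∣-trans (^-monoˡ-∣ s c∣d) d^s∣m) c^s∣E))
            d∣k : d ∣ k
            d∣k = coprime⇒∣k (^-cancel-∣ n≢0 d^s∣N) d⊥e

        isUnit≡isUnitMod-K : ∀ m → m % E ≡ r % E → ⟦ isUnit m ⟧ ≡ ⟦ isUnitMod-K (m % K) ⟧
        isUnit≡isUnitMod-K m m≡r = ⟦does⟧-⇔ (g m ≟ 1) (sgcd s (m % K) K ≟ 1)
          (λ gm≡1 → trans (sgcd-% m K) (SCoprime⇒sgcd≡1 {x = m} K≢0 (λ (d^s∣m , d^s∣K) →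
             sgcd≡1⇒SCoprime {x = m} N≢0 gm≡1 (d^s∣m , ∣-trans d^s∣K K∣N))))
          (λ unit-mod-K → SCoprime⇒sgcd≡1 {x = m} N≢0 (SCoprime-K⇒SCoprime-N m≡r
             (sgcd≡1⇒SCoprime {x = m} K≢0 (trans (sym (sgcd-% m K)) unit-mod-K))))

        unitsIn≡ : unitsIn E r ≡ quotient E∣J * ∑[ b < K ] ⟦ isUnitMod-K b ⟧
        unitsIn≡ = begin
          ∑[ i < N ] h (suc i)
            ≡⟨ ∑-rotate N h h-periodic ⟩
          ∑[ m < N ] h m
            ≡⟨ cong (λ z → ∑[ m < z ] h m) N≡J*K ⟩
          ∑[ m < J * K ] h m
            ≡⟨ ∑-cong (J * K) (λ m _ → h-split m) ⟩
          ∑[ m < J * K ] (⟦ P (m % J) ⟧ * ⟦ isUnitMod-K (m % K) ⟧)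
            ≡⟨ ∑-crt (coprime-^ s j⊥k) P isUnitMod-K ⟩
          ∑[ a < J ] ⟦ P a ⟧ * ∑[ b < K ] ⟦ isUnitMod-K b ⟧
            ≡⟨ cong (_* ∑[ b < K ] ⟦ isUnitMod-K b ⟧) count-P ⟩
          quotient E∣J * ∑[ b < K ] ⟦ isUnitMod-K b ⟧ ∎
          where
            open ≡-Reasoning
            P : ℕ → Bool
            P a = a % E ≡ᵇ r % E
            h : ℕ → ℕ
            h m = ⟦ isUnit m ⟧ * ⟦ P m ⟧
            h-periodic : h N ≡ h 0
            h-periodic = cong₂ (λ u v → ⟦ u ≡ᵇ 1 ⟧ * ⟦ v ≡ᵇ r % E ⟧)
              (trans (sym (sgcd-% N N)) (cong g (n%n≡0 N)))
              (trans (n∣m⇒m%n≡0 N E E∣N) (sym (n∣m⇒m%n≡0 0 E (E ∣0))))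
            h-split : ∀ m → h m ≡ ⟦ P (m % J) ⟧ * ⟦ isUnitMod-K (m % K) ⟧
            h-split m = begin
              ⟦ isUnit m ⟧ * ⟦ P m ⟧                   ≡⟨ *-comm ⟦ isUnit m ⟧ ⟦ P m ⟧ ⟩
              ⟦ P m ⟧ * ⟦ isUnit m ⟧                   ≡⟨ ⟦does⟧*-cong (m % E ≟ r % E) _ _ (isUnit≡isUnitMod-K m) ⟩
              ⟦ P m ⟧ * ⟦ isUnitMod-K (m % K) ⟧
                ≡⟨ cong (λ z → ⟦ z ≡ᵇ r % E ⟧ * ⟦ isUnitMod-K (m % K) ⟧) (m∣n⇒o%n%m≡o%m E J m E∣J) ⟨
              ⟦ P (m % J) ⟧ * ⟦ isUnitMod-K (m % K) ⟧  ∎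
            count-P : ∑[ a < J ] ⟦ P a ⟧ ≡ quotient E∣J
            count-P = trans (cong (λ z → ∑[ a < z ] ⟦ P a ⟧) (_∣_.equality E∣J))
                            (count-residue (quotient E∣J) E (r % E) (m%n<n r E))

      1⊥E : SCoprime 1 E
      1⊥E (d^s∣1 , _) = ^≡1⇒≡1 (∣1⇒≡1 d^s∣1)

      unitsIn-independent : ∀ {r} → SCoprime r E → unitsIn E r ≡ unitsIn E 1
      unitsIn-independent r⊥E = trans (unitsIn≡ r⊥E) (sym (unitsIn≡ 1⊥E))

    y/g : ℕ → ℕ
    y/g y = quotient (g∣x y)

    -- Otherwise (d · G y)^s would be a common s-divisor of y and N larger than g y.
    y/g-SCoprime-D : ∀ y → SCoprime (y/g y) (D y)
    y/g-SCoprime-D y {d} (d^s∣y/g , d^s∣D) =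
      ∣1⇒≡1 (*-cancelʳ-∣ (G y) {{≢-nonZero (G≢0 y)}} (subst (d * G y ∣_) (sym (*-identityˡ (G y))) dG∣G))
      where
        [dG]^s∣ : ∀ {z} → d ^ s ∣ z → (d * G y) ^ s ∣ z * g y
        [dG]^s∣ {z} d^s∣z = subst₂ _∣_ (sym (^-distribʳ-* d (G y) s)) (cong (z *_) (sym (g≡G^s y))) (*-monoˡ-∣ (G y ^ s) d^s∣z)
        dG∣G : d * G y ∣ G y
        dG∣G = proj₂ (G-IsSGCD y)
          ( subst ((d * G y) ^ s ∣_) (sym (_∣_.equality (g∣x y))) ([dG]^s∣ d^s∣y/g)
          , subst ((d * G y) ^ s ∣_) (sym (N≡D*g y)) ([dG]^s∣ d^s∣D))

    divisor-count≡unitsIn : ∀ y →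
      ∑[ i < N ] (⟦ isUnit (suc i) ⟧ * ⟦ does (N ∣? g i * g y) ⟧) ≡ unitsIn (D y) {{≢-nonZero (D≢0 y)}} 1
    divisor-count≡unitsIn y = ∑-cong N (λ i _ → cong (⟦ isUnit (suc i) ⟧ *_)
      (⟦does⟧-⇔ (N ∣? g i * g y) (suc i % D y ≟ 1 % D y)
        (λ N∣gigy → %-remove-+ʳ 1 (N∣g*g⇒D∣ y i (subst (N ∣_) (*-comm (g i) (g y)) N∣gigy)))
        (λ 1+i≡1 → subst (N ∣_) (*-comm (g y) (g i)) (D∣⇒N∣g*g y i (%-≡⇒∣ 1 i (D y) 1+i≡1)))))
      where
        instance
          D-nonZero : NonZero (D y)
          D-nonZero = ≢-nonZero (D≢0 y)

    fixed-count≡unitsIn : ∀ y → y < N →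
      ∑[ i < N ] (⟦ isUnit (suc i) ⟧ * ⟦ (suc i * g y) % N ≡ᵇ y ⟧) ≡ unitsIn (D y) {{≢-nonZero (D≢0 y)}} (y/g y)
    fixed-count≡unitsIn y y<N = ∑-cong N (λ i _ → cong (⟦ isUnit (suc i) ⟧ *_)
      (⟦does⟧-⇔ ((suc i * g y) % N ≟ y) (suc i % D y ≟ y/g y % D y)
        (λ fixed → %-*-cancelʳ (suc i) (y/g y) (D y) (g y) (trans (sym (%-congʳ (N≡D*g y))) (trans fixed y≡)))
        (λ ≡mod → trans (%-congʳ (N≡D*g y)) (trans (%-*-congʳ (suc i) (y/g y) (D y) (g y) ≡mod) (sym y≡)))))
      where
        instance
          D-nonZero : NonZero (D y)
          D-nonZero = ≢-nonZero (D≢0 y)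
          g-nonZero : NonZero (g y)
          g-nonZero = ≢-nonZero (g≢0 y)
          D*g-nonZero : NonZero (D y * g y)
          D*g-nonZero = ≢-nonZero (subst (_≢ 0) (N≡D*g y) N≢0)
        y≡ : y ≡ (y/g y * g y) % (D y * g y)
        y≡ = trans (sym (m<n⇒m%n≡m y<N)) (trans (cong (_% N) (_∣_.equality (g∣x y))) (%-congʳ (N≡D*g y)))

    module _ {m} (m⊥N : SCoprime m N) where

      IsSGCD-multiple : ∀ F → F ≢ 0 → F ^ s ∣ N → IsSGCD ((m * F ^ s) % N) N F
      IsSGCD-multiple F F≢0 F^s∣N = (%-presˡ-∣ (n∣m*n m) F^s∣N , F^s∣N) , greatest
        where
          greatest : ∀ {d} → CommonSDivisor ((m * F ^ s) % N) N d → d ∣ F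
          greatest {d} (d^s∣[mF^s]%N , d^s∣N) = ∣-by-coprime-cofactors F≢0 cofactor≡1
            where
              cofactor≡1 : ∀ {c a b} → c ≢ 0 → F ≡ c * a → d ≡ c * b → Coprime a b → b ≡ 1
              cofactor≡1 {c} {a} {b} c≢0 F≡ca d≡cb a⊥b = m⊥N (b^s∣m , ∣-trans b^s∣d^s d^s∣N)
                where
                  b^s∣d^s : b ^ s ∣ d ^ s
                  b^s∣d^s = ^-monoˡ-∣ s (subst (b ∣_) (sym d≡cb) (n∣m*n c))
                  c^s*b^s∣c^s*[a^s*m] : c ^ s * b ^ s ∣ c ^ s * (a ^ s * m)
                  c^s*b^s∣c^s*[a^s*m] = subst₂ _∣_
                    (trans (cong (_^ s) d≡cb) (^-distribʳ-* c b s))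
                    (trans (cong (λ u → m * u ^ s) F≡ca)
                      (trans (cong (m *_) (^-distribʳ-* c a s)) (trans (*-comm m _) (*-assoc (c ^ s) (a ^ s) m))))
                    (∣n∣m%n⇒∣m d^s∣N d^s∣[mF^s]%N)
                  b^s∣m : b ^ s ∣ m
                  b^s∣m = coprime-divisor (coprime-^ s (Coprimality.sym a⊥b))
                            (*-cancelˡ-∣ (c ^ s) {{≢-nonZero (^≢0 s c≢0)}} c^s*b^s∣c^s*[a^s*m])

      Fixed : ℕ → Bool
      Fixed y = (m * g y) % N ≡ᵇ y

      SDivisor : ℕ → Bool
      SDivisor f = does (suc f ^ s ∣? N)

      multiple : ℕ → ℕ
      multiple f = (m * suc f ^ s) % N

      suc-pred-G : ∀ y → suc (pred (G y)) ≡ G y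
      suc-pred-G y = suc-pred (G y) {{≢-nonZero (G≢0 y)}}

      G-maps : ∀ {y} → y < N → Fixed y ≡ true → pred (G y) < N × SDivisor (pred (G y)) ≡ true
      G-maps {y} _ _ =
        subst (_≤ N) (sym (suc-pred-G y)) (≤-trans (m≤m^s (G y)) (∣⇒≤ G^s∣N)) ,
        dec-true (suc (pred (G y)) ^ s ∣? N) (subst (λ u → u ^ s ∣ N) (sym (suc-pred-G y)) G^s∣N)
        where
          G^s∣N : G y ^ s ∣ N
          G^s∣N = proj₂ (proj₁ (G-IsSGCD y))

      G-injective : ∀ {y z} → y < N → z < N → Fixed y ≡ true → Fixed z ≡ true → pred (G y) ≡ pred (G z) → y ≡ z
      G-injective {y} {z} _ _ fixed-y fixed-z Gy≡Gz = begin
        y                  ≡⟨ does≡true⇒ ((m * g y) % N ≟ y) fixed-y ⟨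
        (m * g y) % N      ≡⟨ cong (λ u → (m * u) % N) g-equal ⟩
        (m * g z) % N      ≡⟨ does≡true⇒ ((m * g z) % N ≟ z) fixed-z ⟩
        z                  ∎
        where
          open ≡-Reasoning
          g-equal : g y ≡ g z
          g-equal = trans (g≡G^s y) (trans (cong (_^ s) (trans (sym (suc-pred-G y))
                      (trans (cong suc Gy≡Gz) (suc-pred-G z)))) (sym (g≡G^s z)))

      G-multiple : ∀ {f} → SDivisor f ≡ true → G (multiple f) ≡ suc f
      G-multiple {f} divisor = IsSGCD-unique (G-IsSGCD (multiple f))
        (IsSGCD-multiple (suc f) (λ ()) (does≡true⇒ (suc f ^ s ∣? N) divisor))

      multiple-maps : ∀ {f} → f < N → SDivisor f ≡ true → multiple f < N × Fixed (multiple f) ≡ true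
      multiple-maps {f} _ divisor = m%n<n _ N ,
        dec-true ((m * g (multiple f)) % N ≟ multiple f)
          (cong (λ u → (m * u) % N) (trans (g≡G^s (multiple f)) (cong (_^ s) (G-multiple divisor))))

      multiple-injective : ∀ {f f′} → f < N → f′ < N → SDivisor f ≡ true → SDivisor f′ ≡ true →
                           multiple f ≡ multiple f′ → f ≡ f′
      multiple-injective _ _ divisor divisor′ same =
        suc-injective (trans (sym (G-multiple divisor)) (trans (cong G same) (G-multiple divisor′)))

      fixed-count≡τ : ∑[ y < N ] ⟦ Fixed y ⟧ ≡ ∑[ f < N ] ⟦ SDivisor f ⟧
      fixed-count≡τ = ≤-antisym
        (count-≤-injection N N Fixed SDivisor (pred ∘ G) G-maps G-injective)
        (count-≤-injection N N SDivisor Fixed multiple multiple-maps multiple-injective)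

    units-weighted-sum : ∑[ i < N ] (⟦ isUnit (suc i) ⟧ * g i)
                         ≡ ∑[ i < N ] ⟦ isUnit (suc i) ⟧ * ∑[ f < N ] ⟦ does (suc f ^ s ∣? N) ⟧
    units-weighted-sum = begin
      ∑[ i < N ] (U i * g i)                 ≡⟨ ∑-cong N (λ i _ → cong (U i *_) (g≡count i)) ⟩
      ∑[ i < N ] (U i * ∑[ y < N ] A i y)    ≡⟨ ∑-cong N (λ i _ → ∑-*ˡ N (U i) (A i)) ⟨
      ∑[ i < N ] ∑[ y < N ] (U i * A i y)    ≡⟨ ∑-comm N N (λ i y → U i * A i y) ⟩
      ∑[ y < N ] ∑[ i < N ] (U i * A i y)    ≡⟨ ∑-cong N divisor-count≡fixed-count ⟩
      ∑[ y < N ] ∑[ i < N ] (U i * B i y)    ≡⟨ ∑-comm N N (λ i y → U i * B i y) ⟨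
      ∑[ i < N ] ∑[ y < N ] (U i * B i y)    ≡⟨ ∑-cong N (λ i _ → ∑-*ˡ N (U i) (B i)) ⟩
      ∑[ i < N ] (U i * ∑[ y < N ] B i y)    ≡⟨ ∑-cong N (λ i _ → ⟦does⟧*-cong (g (suc i) ≟ 1) _ _
                                                   (λ unit → fixed-count≡τ (sgcd≡1⇒SCoprime {x = suc i} N≢0 unit))) ⟩
      ∑[ i < N ] (U i * τₙ)                  ≡⟨ ∑-*ʳ N τₙ U ⟩
      ∑[ i < N ] U i * τₙ                    ∎
      where
        open ≡-Reasoning
        U : ℕ → ℕ
        U i = ⟦ isUnit (suc i) ⟧
        A B : ℕ → ℕ → ℕ
        A i y = ⟦ does (N ∣? g i * g y) ⟧
        B i y = ⟦ (suc i * g y) % N ≡ᵇ y ⟧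
        τₙ : ℕ
        τₙ = ∑[ f < N ] ⟦ does (suc f ^ s ∣? N) ⟧
        divisor-count≡fixed-count : ∀ y → y < N → ∑[ i < N ] (U i * A i y) ≡ ∑[ i < N ] (U i * B i y)
        divisor-count≡fixed-count y y<N = begin
          ∑[ i < N ] (U i * A i y)   ≡⟨ divisor-count≡unitsIn y ⟩
          unitsIn (D y) 1            ≡⟨ ResidueClass.unitsIn-independent (quotient-∣ (G∣n y)) (y/g-SCoprime-D y) ⟨
          unitsIn (D y) (y/g y)      ≡⟨ fixed-count≡unitsIn y y<N ⟨
          ∑[ i < N ] (U i * B i y)   ∎
          where
            instance
              D-nonZero : NonZero (D y)
              D-nonZero = ≢-nonZero (D≢0 y)

    lhsSum≡Φ*τ : lhsSum s N ≡ Φ s N * τ s N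
    lhsSum≡Φ*τ = begin
      lhsSum s N                                             ≡⟨ sum-map-filter (λ m → g m ≟ 1) (λ m → g (m ∸ 1)) (range1 N) ⟩
      sum (map (λ m → ⟦ isUnit m ⟧ * g (m ∸ 1)) (range1 N))   ≡⟨ sum-map-range1 _ N ⟩
      ∑[ i < N ] (⟦ isUnit (suc i) ⟧ * g i)                  ≡⟨ units-weighted-sum ⟩
      ∑[ i < N ] ⟦ isUnit (suc i) ⟧ * ∑[ f < N ] ⟦ does (suc f ^ s ∣? N) ⟧
        ≡⟨ cong₂ _*_ (trans (length-filter (λ m → g m ≟ 1) (range1 N)) (sum-map-range1 _ N))
                     (trans (length-filter (λ l → l ^ s ∣? N) (range1 N)) (sum-map-range1 _ N)) ⟨
      Φ s N * τ s N                                          ∎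
      where open ≡-Reasoning

corollary3p4 : (n s : ℕ) → n ≥ 1 → s ≥ 1 →
    lhsSum s (n ^ s) ≡ Φ s (n ^ s) * τ s (n ^ s)
corollary3p4 n s n≥1 s≥1 = lhsSum≡Φ*τ s {{>-nonZero s≥1}} n {{>-nonZero n≥1}}
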